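{- Let $m\ge1$ and $1\le i\le m$ be integers and let $\mu$ be a partition of $s$ all of whose parts are $\ge i$, and let $j=\sum_{a,d}a\,e_{\mu(a,d)}$. If $m\ge i+2$ and $j>s/(i+1)$, then $\mu$ has at least one part equal to $i$.
   Context: Every integer $x\ge i$ can be written uniquely as $x=i+(a-1)m+d$ with $a\ge1$ and $0\le d\le m-1$; $e_{\mu(a,d)}$ denotes the multiplicity in $\mu$ of the part $i+(a-1)m+d$. -}

module Defs where

open import Data.Nat using (ℕ; zero; suc; _+_; _*_; _∸_; _≤_; _≥_)
open import Data.Nat.Properties using (_≟_)
open import Data.List using (List; []; _∷_)
open import Data.Nat.ListAction using (sum)
open import Data.List.Relation.Unary.All using (All)
open import Data.List.Relation.Unary.Linked using (Linked)
open import Data.Product using (_×_)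
open import Relation.Nullary using (yes; no)
open import Relation.Binary.PropositionalEquality using (_≡_)

IsPartition : ℕ → List ℕ → Set
IsPartition s μ = Linked _≥_ μ × All (λ x → 1 ≤ x) μ × sum μ ≡ s

mult : List ℕ → ℕ → ℕ
mult [] x = 0
mult (y ∷ μ) x with y ≟ x
... | yes _ = suc (mult μ x)
... | no  _ = mult μ x

e : ℕ → ℕ → List ℕ → ℕ → ℕ → ℕ
e i m μ a d = mult μ (i + (a ∸ 1) * m + d)

Σ< : ℕ → (ℕ → ℕ) → ℕ
Σ< zero    f = 0
Σ< (suc n) f = Σ< n f + f n

-- j = Σ_{a ≥ 1, 0 ≤ d ≤ m-1} a e_{μ(a,d)}.  Every part of μ is ≤ s = |μ|,
-- and i + (a-1) m + d ≥ a, so only a ≤ s contributes; we sum over 1 ≤ a ≤ s.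
jStat : ℕ → ℕ → ℕ → List ℕ → ℕ
jStat s i m μ = Σ< s (λ k → Σ< m (λ d → suc k * e i m μ (suc k) d))

-- Each part x contributes to j the index a of the block i + (a-1) m + d (0 ≤ d < m)
-- containing it, and every part other than i is at least (i+1) a: for a = 1 since
-- x > i, and for a ≥ 2 since x ≥ i + (a-1) m ≥ i + (a-1)(i+2) ≥ (i+1) a. Summing
-- over a partition with no part equal to i would give (i+1) j ≤ s.
module Submission where

open import Defs
open import Data.Nat using (ℕ; zero; suc; _+_; _*_; _≤_; _<_; z≤n; _≤?_)
open import Data.Nat.Properties
open import Data.Nat.ListAction using (sum)
open import Data.Nat.Solver using (module +-*-Solver)
open import Data.List using (List; []; _∷_; [_])
open import Data.List.Relation.Unary.All using (All; []; _∷_)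
open import Data.List.Relation.Unary.All.Properties using (¬Any⇒All¬)
open import Data.List.Membership.Propositional using (_∈_)
open import Data.List.Membership.DecPropositional _≟_ using (_∈?_)
open import Data.Product using (_,_)
open import Data.Sum as Sum using (_⊎_; inj₁; inj₂; [_,_]′)
open import Data.Empty using (⊥-elim)
open import Function using (id; _∘′_)
open import Relation.Nullary using (yes; no; contradiction)
open import Relation.Binary.PropositionalEquality using (_≡_; _≢_; refl; sym; trans; cong; cong₂)

open +-*-Solver

Σ<-cong : ∀ n {f g : ℕ → ℕ} → (∀ k → f k ≡ g k) → Σ< n f ≡ Σ< n g
Σ<-cong zero    f≗g = refl
Σ<-cong (suc n) f≗g = cong₂ _+_ (Σ<-cong n f≗g) (f≗g n)

Σ<-+ : ∀ n (f g : ℕ → ℕ) → Σ< n (λ k → f k + g k) ≡ Σ< n f + Σ< n g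
Σ<-+ zero    f g = refl
Σ<-+ (suc n) f g = trans (cong (_+ (f n + g n)) (Σ<-+ n f g))
  (solve 4 (λ a b c d → a :+ b :+ (c :+ d) := a :+ c :+ (b :+ d)) refl
     (Σ< n f) (Σ< n g) (f n) (g n))

*-distribˡ-Σ< : ∀ c n (f : ℕ → ℕ) → c * Σ< n f ≡ Σ< n (λ k → c * f k)
*-distribˡ-Σ< c zero    f = *-zeroʳ c
*-distribˡ-Σ< c (suc n) f =
  trans (*-distribˡ-+ c (Σ< n f) (f n)) (cong (_+ c * f n) (*-distribˡ-Σ< c n f))

Σ<-zero : ∀ n {f : ℕ → ℕ} → (∀ {k} → k < n → f k ≡ 0) → Σ< n f ≡ 0
Σ<-zero zero    f≡0 = refl
Σ<-zero (suc n) f≡0 =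
  cong₂ _+_ (Σ<-zero n (λ k<n → f≡0 (m<n⇒m<1+n k<n))) (f≡0 (n<1+n n))

Σ<-≤-single : ∀ n {f : ℕ → ℕ} {b} →
  (∀ {k l} → k < l → f k ≡ 0 ⊎ f l ≡ 0) → (∀ k → f k ≤ b) → Σ< n f ≤ b
Σ<-≤-single zero    apart f≤b = z≤n
Σ<-≤-single (suc n) {f} apart f≤b with f n ≟ 0
... | yes fn≡0 rewrite fn≡0 | +-identityʳ (Σ< n f) = Σ<-≤-single n apart f≤b
... | no  fn≢0 rewrite Σ<-zero n (λ k<n → [ id , ⊥-elim ∘′ fn≢0 ]′ (apart k<n)) = f≤b n

mult-∷ : ∀ x μ y → mult (x ∷ μ) y ≡ mult [ x ] y + mult μ y
mult-∷ x μ y with x ≟ y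
... | yes _ = refl
... | no  _ = refl

mult-singleton-≤1 : ∀ x y → mult [ x ] y ≤ 1
mult-singleton-≤1 x y with x ≟ y
... | yes _ = ≤-refl
... | no  _ = z≤n

mult-singleton-≢ : ∀ {x y} → x ≢ y → mult [ x ] y ≡ 0
mult-singleton-≢ {x} {y} x≢y with x ≟ y
... | yes x≡y = contradiction x≡y x≢y
... | no  _   = refl

mult-singleton-apart : ∀ x {a b} → a ≢ b → mult [ x ] a ≡ 0 ⊎ mult [ x ] b ≡ 0
mult-singleton-apart x {a} a≢b with x ≟ a
... | yes x≡a = inj₂ (mult-singleton-≢ (a≢b ∘′ trans (sym x≡a)))
... | no  _   = inj₁ refl

jStat-[] : ∀ s i m → jStat s i m [] ≡ 0
jStat-[] s i m = Σ<-zero s (λ {k} _ → Σ<-zero m (λ _ → *-zeroʳ (suc k)))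

jStat-∷ : ∀ s i m x μ → jStat s i m (x ∷ μ) ≡ jStat s i m [ x ] + jStat s i m μ
jStat-∷ s i m x μ =
  trans (Σ<-cong s (λ k → trans (Σ<-cong m (λ d → split k (i + k * m + d)))
                                 (Σ<-+ m (term [ x ] k) (term μ k))))
        (Σ<-+ s (λ k → Σ< m (term [ x ] k)) (λ k → Σ< m (term μ k)))
  where
  term : List ℕ → ℕ → ℕ → ℕ
  term ν k d = suc k * mult ν (i + k * m + d)

  split : ∀ k y → suc k * mult (x ∷ μ) y ≡ suc k * mult [ x ] y + suc k * mult μ y
  split k y = trans (cong (suc k *_) (mult-∷ x μ y))
                    (*-distribˡ-+ (suc k) (mult [ x ] y) (mult μ y))

window : ℕ → ℕ → ℕ → ℕ → ℕ
window w t n x = Σ< n (λ d → w * mult [ x ] (t + d))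

window-≤ : ∀ w t n x → window w t n x ≤ w
window-≤ w t n x = Σ<-≤-single n apart term≤w
  where
  apart : ∀ {d e} → d < e → w * mult [ x ] (t + d) ≡ 0 ⊎ w * mult [ x ] (t + e) ≡ 0
  apart {d} {e} d<e = Sum.map scaled-zero scaled-zero
    (mult-singleton-apart x (<⇒≢ d<e ∘′ +-cancelˡ-≡ t d e))
    where
    scaled-zero : ∀ {y} → mult [ x ] y ≡ 0 → w * mult [ x ] y ≡ 0
    scaled-zero eq = trans (cong (w *_) eq) (*-zeroʳ w)

  term≤w : ∀ d → w * mult [ x ] (t + d) ≤ w
  term≤w d = ≤-trans (*-monoʳ-≤ w (mult-singleton-≤1 x (t + d))) (≤-reflexive (*-identityʳ w))

window-outside : ∀ w t n x → x < t ⊎ t + n ≤ x → window w t n x ≡ 0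
window-outside w t n x outside = Σ<-zero n (λ {d} d<n →
  trans (cong (w *_) (mult-singleton-≢ (x≢t+d d<n))) (*-zeroʳ w))
  where
  x≢t+d : ∀ {d} → d < n → x ≢ t + d
  x≢t+d {d} d<n = [ (λ x<t → <⇒≢ (<-≤-trans x<t (m≤m+n t d)))
                      , (λ t+n≤x → >⇒≢ (<-≤-trans (+-monoʳ-< t d<n) t+n≤x)) ]′ outside

block-end : ∀ i k m → i + k * m + m ≡ i + suc k * m
block-end = solve 3 (λ i k m → i :+ k :* m :+ m := i :+ (con 1 :+ k) :* m) refl

block-index-bound : ∀ {i m x} k → suc (suc i) ≤ m → i ≤ x → i ≢ x →
  i + k * m ≤ x → suc i * suc k ≤ x
block-index-bound {i} {m} {x} zero _ i≤x i≢x _ =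
  ≤-trans (≤-reflexive (*-identityʳ (suc i))) (≤∧≢⇒< i≤x i≢x)
block-index-bound {i} {m} {x} (suc k) i+2≤m _ _ start≤x = begin
  suc i * suc (suc k)          ≤⟨ m≤m+n _ k ⟩
  suc i * suc (suc k) + k      ≡⟨ solve 2 (λ i k → (con 1 :+ i) :* (con 2 :+ k) :+ k
                                    := i :+ (con 1 :+ k) :* (con 2 :+ i)) refl i k ⟩
  i + suc k * suc (suc i)      ≤⟨ +-monoʳ-≤ i (*-monoʳ-≤ (suc k) i+2≤m) ⟩
  i + suc k * m                ≤⟨ start≤x ⟩
  x                            ∎
  where open ≤-Reasoning

part-weight-bound : ∀ s {i m x} → suc (suc i) ≤ m → i ≤ x → i ≢ x →
  suc i * jStat s i m [ x ] ≤ x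
part-weight-bound s {i} {m} {x} i+2≤m i≤x i≢x = begin
  suc i * jStat s i m [ x ]            ≡⟨ *-distribˡ-Σ< (suc i) s block ⟩
  Σ< s (λ k → suc i * block k)         ≤⟨ Σ<-≤-single s apart weighted≤x ⟩
  x                                    ∎
  where
  open ≤-Reasoning

  block : ℕ → ℕ
  block k = window (suc k) (i + k * m) m x

  scaled-zero : ∀ k → block k ≡ 0 → suc i * block k ≡ 0
  scaled-zero k eq = trans (cong (suc i *_) eq) (*-zeroʳ (suc i))

  apart : ∀ {k l} → k < l → suc i * block k ≡ 0 ⊎ suc i * block l ≡ 0
  apart {k} {l} k<l with i + l * m ≤? x
  ... | yes lstart≤x = inj₁ (scaled-zero k (window-outside (suc k) (i + k * m) m x (inj₂ (begin
    i + k * m + m     ≡⟨ block-end i k m ⟩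
    i + suc k * m     ≤⟨ +-monoʳ-≤ i (*-monoˡ-≤ m k<l) ⟩
    i + l * m         ≤⟨ lstart≤x ⟩
    x                 ∎))))
  ... | no  lstart≰x =
    inj₂ (scaled-zero l (window-outside (suc l) (i + l * m) m x (inj₁ (≰⇒> lstart≰x))))

  weighted≤x : ∀ k → suc i * block k ≤ x
  weighted≤x k with i + k * m ≤? x
  ... | yes start≤x = ≤-trans (*-monoʳ-≤ (suc i) (window-≤ (suc k) _ m x))
                              (block-index-bound k i+2≤m i≤x i≢x start≤x)
  ... | no  start≰x =
    ≤-trans (≤-reflexive (scaled-zero k
      (window-outside (suc k) (i + k * m) m x (inj₁ (≰⇒> start≰x))))) z≤n

jStat-bound : ∀ s {i m} (μ : List ℕ) → suc (suc i) ≤ m →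
  All (i ≤_) μ → All (i ≢_) μ → suc i * jStat s i m μ ≤ sum μ
jStat-bound s {i} {m} [] _ [] [] rewrite jStat-[] s i m | *-zeroʳ i = z≤n
jStat-bound s {i} {m} (x ∷ μ) i+2≤m (i≤x ∷ i≤μ) (i≢x ∷ i∉μ)
  rewrite jStat-∷ s i m x μ | *-distribˡ-+ (suc i) (jStat s i m [ x ]) (jStat s i m μ) =
  +-mono-≤ (part-weight-bound s i+2≤m i≤x i≢x) (jStat-bound s μ i+2≤m i≤μ i∉μ)

lemma7 : (m i s : ℕ) (μ : List ℕ) → 1 ≤ m → 1 ≤ i → i ≤ m →
    IsPartition s μ → All (λ x → i ≤ x) μ →
    suc (suc i) ≤ m → s < suc i * jStat s i m μ →
    i ∈ μ
lemma7 m i s μ _ _ _ (_ , _ , Σμ≡s) i≤μ i+2≤m s<j with i ∈? μ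
... | yes i∈μ = i∈μ
... | no  i∉μ = contradiction
  (≤-trans (jStat-bound s μ i+2≤m i≤μ (¬Any⇒All¬ μ i∉μ)) (≤-reflexive Σμ≡s))
  (<⇒≱ s<j)
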